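{- Let $\Gamma_1$ and $\Gamma_2$ be simple graphs on $n_1$ and $n_2$ vertices (with disjoint vertex sets) with adjacency matrices $A_1$ and $A_2$, let $A$ be the adjacency matrix of the join $\Gamma_1\vee\Gamma_2$, and suppose the binary codes $C([I_{n_1}|A_1])$ and $C([I_{n_2}|A_2])$ are self-dual (so that $C([I_{n_1+n_2}|A])$ is self-dual as well). Then: (a) If $n_1\equiv n_2\equiv 0\pmod 4$, then $C([I_{n_1+n_2}|A])$ is Type II if and only if both $C([I_{n_1}|A_1])$ and $C([I_{n_2}|A_2])$ are Type II. (b) If $n_1\equiv n_2\equiv 2\pmod 4$ and $C([I_{n_1+n_2}|A])$ is Type II, then both $C([I_{n_1}|A_1])$ and $C([I_{n_2}|A_2])$ are Type I; conversely, if every vertex of $\Gamma_1$ and of $\Gamma_2$ has degree $\equiv 1\pmod 4$, then $C([I_{n_1+n_2}|A])$ is Type II. (c) If exactly one of $n_1,n_2$ is divisible by $4$, then $C([I_{n_1+n_2}|A])$ is Type I.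
   Context: $C(G)$ denotes the binary code generated by (row space over $\mathbb{F}_2$ of) the matrix $G$. The join $\Gamma_1\vee\Gamma_2$ has vertex set $V_1\cup V_2$ and all edges of $\Gamma_1$, of $\Gamma_2$, and all edges between $V_1$ and $V_2$. A binary code $C$ is self-dual if $C=C^\perp$; a self-dual code is Type II if all codeword Hamming weights are divisible by $4$, and Type I otherwise. -}

module Defs where

open import Data.Bool using (Bool; true; false; _xor_; _∧_; if_then_else_)
open import Data.Nat using (ℕ; zero; suc; _+_; _%_)
open import Data.Nat.Divisibility using (_∣_)
open import Data.Fin using (Fin; splitAt) renaming (zero to fz; suc to fs)
open import Data.Fin.Properties using () renaming (_≟_ to _≟F_)
open import Data.Sum using (_⊎_; inj₁; inj₂)
open import Data.Product using (_×_; Σ; ∃)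
open import Relation.Nullary using (¬_; does)
open import Relation.Binary.PropositionalEquality using (_≡_)

-- Binary vectors of length m over F₂ = Bool (xor is addition, ∧ multiplication)
BVec : ℕ → Set
BVec m = Fin m → Bool

⊕Σ : {n : ℕ} → (Fin n → Bool) → Bool
⊕Σ {zero}  f = false
⊕Σ {suc n} f = f fz xor ⊕Σ (λ i → f (fs i))

ΣN : {n : ℕ} → (Fin n → ℕ) → ℕ
ΣN {zero}  f = 0
ΣN {suc n} f = f fz + ΣN (λ i → f (fs i))

wt : {m : ℕ} → BVec m → ℕ
wt x = ΣN (λ j → if x j then 1 else 0)

dot : {m : ℕ} → BVec m → BVec m → Bool
dot x y = ⊕Σ (λ j → x j ∧ y j)

Code : ℕ → Set₁
Code m = BVec m → Set

C : {k m : ℕ} → (Fin k → Fin m → Bool) → Code m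
C {k} G x = ∃ λ (c : Fin k → Bool) → ∀ j → x j ≡ ⊕Σ (λ i → c i ∧ G i j)

_⊥ : {m : ℕ} → Code m → Code m
(D ⊥) y = ∀ x → D x → dot x y ≡ false

SelfDual : {m : ℕ} → Code m → Set
SelfDual D = ∀ y → (D y → (D ⊥) y) × ((D ⊥) y → D y)

DoublyEven : {m : ℕ} → Code m → Set
DoublyEven D = ∀ x → D x → 4 ∣ wt x

TypeII : {m : ℕ} → Code m → Set
TypeII D = SelfDual D × DoublyEven D

TypeI : {m : ℕ} → Code m → Set
TypeI D = SelfDual D × ¬ DoublyEven D

record Graph (n : ℕ) : Set where
  field
    adj   : Fin n → Fin n → Bool
    sym   : ∀ i j → adj i j ≡ adj j i
    irref : ∀ i → adj i i ≡ false
open Graph public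

degree : {n : ℕ} → Graph n → Fin n → ℕ
degree Γ v = wt (adj Γ v)

-- adjacency matrix of the join Γ₁ ∨ Γ₂ on Fin (n₁ + n₂):
-- the first n₁ vertices are those of Γ₁, the last n₂ those of Γ₂
joinAdj : {n₁ n₂ : ℕ} → Graph n₁ → Graph n₂ → Fin (n₁ + n₂) → Fin (n₁ + n₂) → Bool
joinAdj {n₁} Γ₁ Γ₂ i j with splitAt n₁ i | splitAt n₁ j
... | inj₁ a | inj₁ b = adj Γ₁ a b
... | inj₂ a | inj₂ b = adj Γ₂ a b
... | inj₁ _ | inj₂ _ = true
... | inj₂ _ | inj₁ _ = true

IA : {n : ℕ} → (Fin n → Fin n → Bool) → Fin n → Fin (n + n) → Bool
IA {n} A i j with splitAt n j
... | inj₁ k = does (i ≟F k)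
... | inj₂ k = A i k

codeOf : {n : ℕ} → Graph n → Code (n + n)
codeOf Γ = C (IA (adj Γ))

joinCode : {n₁ n₂ : ℕ} → Graph n₁ → Graph n₂ → Code ((n₁ + n₂) + (n₁ + n₂))
joinCode Γ₁ Γ₂ = C (IA (joinAdj Γ₁ Γ₂))

-- For symmetric A, the code C([I | A]) is self-dual exactly when A Aᵀ = I over F₂. For a graph
-- this says that all degrees are odd and any two vertices have evenly many common neighbours,
-- which forces an even number of vertices; all of this passes to the join. A self-dual code
-- spanned by doubly-even rows is doubly even, so C([I | A]) is Type II iff 1 + deg v ≡ 0 (mod 4)
-- for every vertex v. Joining adds the order of the other graph to every degree, which gives
-- (a) and (b). For (c), a Type II code C([I | A]) of length 2n has 4 ∣ n: in F₅ the element
-- ω = 2 is a primitive fourth root of unity, and ∑_{c,e} ω^(wt c + wt (cA + e)) equals 4ⁿ by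
-- translation invariance in e and 2ⁿ by orthogonality of characters, so ω^n = 1.

module Submission where

open import Defs hiding (sym)
open import Data.Bool using (Bool; true; false; _xor_; _∧_; if_then_else_)
open import Data.Bool.Properties
  using (xor-assoc; xor-comm; xor-same; xor-identityʳ; ∧-comm; ∧-assoc; ∧-zeroʳ; ∧-identityʳ; ∧-idem; ∧-distribˡ-xor)
  renaming (_≟_ to _≟ᴮ_)
open import Data.Nat using (ℕ; zero; suc; _+_; _*_; _/_; _%_; _<_; s≤s)
open import Data.Nat.Properties using (+-assoc; +-comm; +-suc; *-distribˡ-+)
open import Data.Nat.DivMod using (_mod_; m≡m%n+[m/n]*n; m%n<n; %-distribˡ-+)
open import Data.Nat.Divisibility using (_∣_; divides; _∣0; m%n≡0⇒n∣m; n∣m⇒m%n≡0; ∣m+n∣m⇒∣n; ∣m∣n⇒∣m+n)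
open import Data.Nat.Tactic.RingSolver using (solve-∀)
open import Data.Fin using (Fin; zero; suc; #_; toℕ; splitAt; _↑ˡ_; _↑ʳ_)
open import Data.Fin.Properties
  using (all?; _≟_; splitAt-↑ˡ; splitAt-↑ʳ; splitAt⁻¹-↑ˡ; splitAt⁻¹-↑ʳ; ↑ˡ-injective; ↑ʳ-injective)
open import Data.Vec.Functional using ([]; _∷_)
open import Data.Sum using (_⊎_; inj₁; inj₂)
open import Data.Product using (_×_; _,_; ∃; proj₁; proj₂)
open import Function using (_∘_; _⇔_; mk⇔; Equivalence)
open import Relation.Nullary using (¬_; does; yes; no; contradiction)
open import Relation.Nullary.Decidable using (True; toWitness; dec-true; dec-false)
open import Relation.Binary.PropositionalEquality
open ≡-Reasoning

-- The field F₅

F₅ : Set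
F₅ = Fin 5

infixl 6 _+₅_
infixl 7 _*₅_
infixr 8 _^₅_

_+₅_ _*₅_ : F₅ → F₅ → F₅
a +₅ b = (toℕ a + toℕ b) mod 5
a *₅ b = (toℕ a * toℕ b) mod 5

byEvaluation₁ : (f g : F₅ → F₅) → {True (all? λ a → f a ≟ g a)} → ∀ a → f a ≡ g a
byEvaluation₁ f g {t} = toWitness t

byEvaluation₂ : (f g : F₅ → F₅ → F₅) → {True (all? λ a → all? λ b → f a b ≟ g a b)}
  → ∀ a b → f a b ≡ g a b
byEvaluation₂ f g {t} = toWitness t

byEvaluation₃ : (f g : F₅ → F₅ → F₅ → F₅)
  → {True (all? λ a → all? λ b → all? λ c → f a b c ≟ g a b c)}
  → ∀ a b c → f a b c ≡ g a b c
byEvaluation₃ f g {t} = toWitness t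

byEvaluation₄ : (f g : F₅ → F₅ → F₅ → F₅ → F₅)
  → {True (all? λ a → all? λ b → all? λ c → all? λ d → f a b c d ≟ g a b c d)}
  → ∀ a b c d → f a b c d ≡ g a b c d
byEvaluation₄ f g {t} = toWitness t

+₅-identityʳ : ∀ a → a +₅ # 0 ≡ a
+₅-identityʳ = byEvaluation₁ (λ a → a +₅ # 0) (λ a → a)

*₅-comm : ∀ a b → a *₅ b ≡ b *₅ a
*₅-comm = byEvaluation₂ (λ a b → a *₅ b) (λ a b → b *₅ a)

*₅-assoc : ∀ a b c → (a *₅ b) *₅ c ≡ a *₅ (b *₅ c)
*₅-assoc = byEvaluation₃ (λ a b c → (a *₅ b) *₅ c) (λ a b c → a *₅ (b *₅ c))

*₅-identityˡ : ∀ a → # 1 *₅ a ≡ a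
*₅-identityˡ = byEvaluation₁ (λ a → # 1 *₅ a) (λ a → a)

*₅-identityʳ : ∀ a → a *₅ # 1 ≡ a
*₅-identityʳ = byEvaluation₁ (λ a → a *₅ # 1) (λ a → a)

*₅-zeroˡ : ∀ a → # 0 *₅ a ≡ # 0
*₅-zeroˡ = byEvaluation₁ (λ a → # 0 *₅ a) (λ _ → # 0)

*₅-zeroʳ : ∀ a → a *₅ # 0 ≡ # 0
*₅-zeroʳ = byEvaluation₁ (λ a → a *₅ # 0) (λ _ → # 0)

*₅-distribˡ-+₅ : ∀ a b c → a *₅ (b +₅ c) ≡ a *₅ b +₅ a *₅ c
*₅-distribˡ-+₅ = byEvaluation₃ (λ a b c → a *₅ (b +₅ c)) (λ a b c → a *₅ b +₅ a *₅ c)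

*₅-distribʳ-+₅ : ∀ a b c → (a +₅ b) *₅ c ≡ a *₅ c +₅ b *₅ c
*₅-distribʳ-+₅ = byEvaluation₃ (λ a b c → (a +₅ b) *₅ c) (λ a b c → a *₅ c +₅ b *₅ c)

+₅-interchange : ∀ a b c d → (a +₅ b) +₅ (c +₅ d) ≡ (a +₅ c) +₅ (b +₅ d)
+₅-interchange = byEvaluation₄ (λ a b c d → (a +₅ b) +₅ (c +₅ d)) (λ a b c d → (a +₅ c) +₅ (b +₅ d))

*₅-interchange : ∀ a b c d → (a *₅ b) *₅ (c *₅ d) ≡ (a *₅ c) *₅ (b *₅ d)
*₅-interchange = byEvaluation₄ (λ a b c d → (a *₅ b) *₅ (c *₅ d)) (λ a b c d → (a *₅ c) *₅ (b *₅ d))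

idempotent⇒≡1 : ∀ x → x *₅ x ≡ x → x ≢ # 0 → x ≡ # 1
idempotent⇒≡1 zero                            _  x≢0 = contradiction refl x≢0
idempotent⇒≡1 (suc zero)                      _  _   = refl
idempotent⇒≡1 (suc (suc zero))                () _
idempotent⇒≡1 (suc (suc (suc zero)))          () _
idempotent⇒≡1 (suc (suc (suc (suc zero))))    () _

_^₅_ : F₅ → ℕ → F₅
a ^₅ zero  = # 1
a ^₅ suc n = a *₅ a ^₅ n

^₅-distribˡ-+ : ∀ a m n → a ^₅ (m + n) ≡ a ^₅ m *₅ a ^₅ n
^₅-distribˡ-+ a zero    n = sym (*₅-identityˡ (a ^₅ n))
^₅-distribˡ-+ a (suc m) n = begin
  a *₅ a ^₅ (m + n)         ≡⟨ cong (a *₅_) (^₅-distribˡ-+ a m n) ⟩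
  a *₅ (a ^₅ m *₅ a ^₅ n)   ≡⟨ sym (*₅-assoc a (a ^₅ m) (a ^₅ n)) ⟩
  a *₅ a ^₅ m *₅ a ^₅ n     ∎

^₅-distribʳ-*₅ : ∀ a b n → (a *₅ b) ^₅ n ≡ a ^₅ n *₅ b ^₅ n
^₅-distribʳ-*₅ a b zero    = refl
^₅-distribʳ-*₅ a b (suc n) = begin
  (a *₅ b) *₅ (a *₅ b) ^₅ n        ≡⟨ cong ((a *₅ b) *₅_) (^₅-distribʳ-*₅ a b n) ⟩
  (a *₅ b) *₅ (a ^₅ n *₅ b ^₅ n)   ≡⟨ *₅-interchange a b (a ^₅ n) (b ^₅ n) ⟩
  a ^₅ suc n *₅ b ^₅ suc n         ∎

-- ω has multiplicative order 4, so ω ^₅ m records m mod 4.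
ω : F₅
ω = # 2

ω^[4q]≡1 : ∀ q → ω ^₅ (q * 4) ≡ # 1
ω^[4q]≡1 zero    = refl
ω^[4q]≡1 (suc q) = trans (^₅-distribˡ-+ ω 4 (q * 4)) (cong (ω ^₅ 4 *₅_) (ω^[4q]≡1 q))

4∣⇒ω^≡1 : ∀ {m} → 4 ∣ m → ω ^₅ m ≡ # 1
4∣⇒ω^≡1 (divides q refl) = ω^[4q]≡1 q

ω^≡ω^[%4] : ∀ m → ω ^₅ m ≡ ω ^₅ (m % 4)
ω^≡ω^[%4] m = begin
  ω ^₅ m                               ≡⟨ cong (ω ^₅_) (m≡m%n+[m/n]*n m 4) ⟩
  ω ^₅ (m % 4 + (m / 4) * 4)           ≡⟨ ^₅-distribˡ-+ ω (m % 4) _ ⟩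
  ω ^₅ (m % 4) *₅ ω ^₅ ((m / 4) * 4)   ≡⟨ cong (ω ^₅ (m % 4) *₅_) (ω^[4q]≡1 (m / 4)) ⟩
  ω ^₅ (m % 4) *₅ # 1                  ≡⟨ *₅-identityʳ _ ⟩
  ω ^₅ (m % 4)                         ∎

ω^≡1⇒4∣ : ∀ m → ω ^₅ m ≡ # 1 → 4 ∣ m
ω^≡1⇒4∣ m ω^m≡1 = m%n≡0⇒n∣m m 4 (below4 (m % 4) (m%n<n m 4) (trans (sym (ω^≡ω^[%4] m)) ω^m≡1))
  where
  below4 : ∀ r → r < 4 → ω ^₅ r ≡ # 1 → r ≡ 0
  below4 0 _ _ = refl
  below4 1 _ ()
  below4 2 _ ()
  below4 3 _ ()
  below4 (suc (suc (suc (suc _)))) (s≤s (s≤s (s≤s (s≤s ()))))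

ω^≢0 : ∀ m → ω ^₅ m ≢ # 0
ω^≢0 zero    ()
ω^≢0 (suc m) eq = ω^≢0 m (cancelω (ω ^₅ m) eq)
  where
  cancelω : ∀ x → ω *₅ x ≡ # 0 → x ≡ # 0
  cancelω zero                           _ = refl
  cancelω (suc zero)                     ()
  cancelω (suc (suc zero))               ()
  cancelω (suc (suc (suc zero)))         ()
  cancelω (suc (suc (suc (suc zero))))   ()

[ω*ω]^≡ω^⇒4∣ : ∀ n → (ω *₅ ω) ^₅ n ≡ ω ^₅ n → 4 ∣ n
[ω*ω]^≡ω^⇒4∣ n eq = ω^≡1⇒4∣ n (idempotent⇒≡1 (ω ^₅ n) (trans (sym (^₅-distribʳ-*₅ ω ω n)) eq) (ω^≢0 n))

sign : Bool → F₅
sign false = # 1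
sign true  = # 4

sign-xor : ∀ a b → sign (a xor b) ≡ sign a *₅ sign b
sign-xor true  true  = refl
sign-xor true  false = refl
sign-xor false true  = refl
sign-xor false false = refl

sign-involutive : ∀ b → sign b *₅ sign b ≡ # 1
sign-involutive true  = refl
sign-involutive false = refl

*₅-sign-cancel : ∀ {a c} b → a *₅ sign b ≡ c → a ≡ c *₅ sign b
*₅-sign-cancel {a} {c} b a*s≡c = begin
  a                         ≡⟨ sym (*₅-identityʳ a) ⟩
  a *₅ # 1                  ≡⟨ cong (a *₅_) (sym (sign-involutive b)) ⟩
  a *₅ (sign b *₅ sign b)   ≡⟨ sym (*₅-assoc a (sign b) (sign b)) ⟩
  a *₅ sign b *₅ sign b     ≡⟨ cong (_*₅ sign b) a*s≡c ⟩
  c *₅ sign b               ∎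

-- Vectors and matrices over F₂

xor-interchange : ∀ a b c d → (a xor b) xor (c xor d) ≡ (a xor c) xor (b xor d)
xor-interchange a b c d = begin
  (a xor b) xor (c xor d)   ≡⟨ xor-assoc a b (c xor d) ⟩
  a xor (b xor (c xor d))   ≡⟨ cong (a xor_) (sym (xor-assoc b c d)) ⟩
  a xor ((b xor c) xor d)   ≡⟨ cong (λ x → a xor (x xor d)) (xor-comm b c) ⟩
  a xor ((c xor b) xor d)   ≡⟨ cong (a xor_) (xor-assoc c b d) ⟩
  a xor (c xor (b xor d))   ≡⟨ sym (xor-assoc a c (b xor d)) ⟩
  (a xor c) xor (b xor d)   ∎

xor≡false⇒≡ : ∀ {a b} → a xor b ≡ false → b ≡ a
xor≡false⇒≡ {true}  {true}  _ = refl
xor≡false⇒≡ {false} {false} _ = refl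

↑-view : ∀ m {n} (j : Fin (m + n)) → (∃ λ a → a ↑ˡ n ≡ j) ⊎ (∃ λ b → m ↑ʳ b ≡ j)
↑-view m j with splitAt m j in eq
... | inj₁ a = inj₁ (a , splitAt⁻¹-↑ˡ eq)
... | inj₂ b = inj₂ (b , splitAt⁻¹-↑ʳ eq)

↑ˡ≢↑ʳ : ∀ {m n} (a : Fin m) (b : Fin n) → a ↑ˡ n ≢ m ↑ʳ b
↑ˡ≢↑ʳ {m} {n} a b eq with trans (sym (splitAt-↑ˡ m a n)) (trans (cong (splitAt m) eq) (splitAt-↑ʳ m n b))
... | ()

does-≟-sym : ∀ {n} (i j : Fin n) → does (i ≟ j) ≡ does (j ≟ i)
does-≟-sym i j with i ≟ j
... | yes i≡j = sym (dec-true (j ≟ i) (sym i≡j))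
... | no  i≢j = sym (dec-false (j ≟ i) (i≢j ∘ sym))

does-≟-injective : ∀ {m n} (f : Fin m → Fin n) → (∀ {a b} → f a ≡ f b → a ≡ b)
  → ∀ a b → does (f a ≟ f b) ≡ does (a ≟ b)
does-≟-injective f f-inj a b with a ≟ b
... | yes a≡b = dec-true (f a ≟ f b) (cong f a≡b)
... | no  a≢b = dec-false (f a ≟ f b) (a≢b ∘ f-inj)

⊕Σ-cong : ∀ {n} {f g : Fin n → Bool} → (∀ i → f i ≡ g i) → ⊕Σ f ≡ ⊕Σ g
⊕Σ-cong {zero}  _   = refl
⊕Σ-cong {suc n} f≗g = cong₂ _xor_ (f≗g zero) (⊕Σ-cong (f≗g ∘ suc))

⊕Σ-false : ∀ {n} → ⊕Σ {n} (λ _ → false) ≡ false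
⊕Σ-false {zero}  = refl
⊕Σ-false {suc n} = ⊕Σ-false {n}

⊕Σ-zero : ∀ {n} {f : Fin n → Bool} → (∀ i → f i ≡ false) → ⊕Σ f ≡ false
⊕Σ-zero {n} f≗0 = trans (⊕Σ-cong f≗0) (⊕Σ-false {n})

⊕Σ-xor : ∀ {n} (f g : Fin n → Bool) → ⊕Σ (λ i → f i xor g i) ≡ ⊕Σ f xor ⊕Σ g
⊕Σ-xor {zero}  f g = refl
⊕Σ-xor {suc n} f g = trans (cong ((f zero xor g zero) xor_) (⊕Σ-xor (f ∘ suc) (g ∘ suc)))
                           (xor-interchange (f zero) (g zero) (⊕Σ (f ∘ suc)) (⊕Σ (g ∘ suc)))

∧-distribˡ-⊕Σ : ∀ {n} b (f : Fin n → Bool) → b ∧ ⊕Σ f ≡ ⊕Σ (λ i → b ∧ f i)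
∧-distribˡ-⊕Σ {zero}  b f = ∧-zeroʳ b
∧-distribˡ-⊕Σ {suc n} b f = trans (∧-distribˡ-xor b (f zero) _) (cong ((b ∧ f zero) xor_) (∧-distribˡ-⊕Σ b (f ∘ suc)))

∧-distribʳ-⊕Σ : ∀ {n} b (f : Fin n → Bool) → ⊕Σ f ∧ b ≡ ⊕Σ (λ i → f i ∧ b)
∧-distribʳ-⊕Σ b f = trans (∧-comm (⊕Σ f) b) (trans (∧-distribˡ-⊕Σ b f) (⊕Σ-cong (λ i → ∧-comm b (f i))))

⊕Σ-comm : ∀ {m n} (f : Fin m → Fin n → Bool) → ⊕Σ (λ i → ⊕Σ (f i)) ≡ ⊕Σ (λ k → ⊕Σ (λ i → f i k))
⊕Σ-comm {zero}  {n} f = sym (⊕Σ-false {n})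
⊕Σ-comm {suc m}     f = trans (cong (⊕Σ (f zero) xor_) (⊕Σ-comm (f ∘ suc)))
                              (sym (⊕Σ-xor (f zero) (λ k → ⊕Σ (λ i → f (suc i) k))))

⊕Σ-splitAt : ∀ m {n} (f : Fin (m + n) → Bool) → ⊕Σ f ≡ ⊕Σ (λ i → f (i ↑ˡ n)) xor ⊕Σ (λ i → f (m ↑ʳ i))
⊕Σ-splitAt zero    f = refl
⊕Σ-splitAt (suc m) f = trans (cong (f zero xor_) (⊕Σ-splitAt m (f ∘ suc))) (sym (xor-assoc (f zero) _ _))

⊕Σ-δˡ : ∀ {n} (i : Fin n) (g : Fin n → Bool) → ⊕Σ (λ k → does (i ≟ k) ∧ g k) ≡ g i
⊕Σ-δˡ {suc n} zero    g = trans (cong (g zero xor_) (⊕Σ-false {n})) (xor-identityʳ (g zero))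
⊕Σ-δˡ {suc n} (suc i) g = ⊕Σ-δˡ i (g ∘ suc)

⊕Σ-δʳ : ∀ {n} (i : Fin n) (g : Fin n → Bool) → ⊕Σ (λ k → g k ∧ does (k ≟ i)) ≡ g i
⊕Σ-δʳ {suc n} zero    g = trans (cong₂ _xor_ (∧-identityʳ (g zero)) (⊕Σ-zero (λ k → ∧-zeroʳ (g (suc k)))))
                                (xor-identityʳ (g zero))
⊕Σ-δʳ {suc n} (suc i) g = trans (cong (_xor ⊕Σ (λ k → g (suc k) ∧ does (k ≟ i))) (∧-zeroʳ (g zero)))
                                (⊕Σ-δʳ i (g ∘ suc))

ΣN-cong : ∀ {n} {f g : Fin n → ℕ} → (∀ i → f i ≡ g i) → ΣN f ≡ ΣN g
ΣN-cong {zero}  _   = refl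
ΣN-cong {suc n} f≗g = cong₂ _+_ (f≗g zero) (ΣN-cong (f≗g ∘ suc))

ΣN-splitAt : ∀ m {n} (f : Fin (m + n) → ℕ) → ΣN f ≡ ΣN (λ i → f (i ↑ˡ n)) + ΣN (λ i → f (m ↑ʳ i))
ΣN-splitAt zero    f = refl
ΣN-splitAt (suc m) f = trans (cong (f zero +_) (ΣN-splitAt m (f ∘ suc))) (sym (+-assoc (f zero) _ _))

ΣN-0 : ∀ {n} → ΣN {n} (λ _ → 0) ≡ 0
ΣN-0 {zero}  = refl
ΣN-0 {suc n} = ΣN-0 {n}

ΣN-1 : ∀ {n} → ΣN {n} (λ _ → 1) ≡ n
ΣN-1 {zero}  = refl
ΣN-1 {suc n} = cong suc (ΣN-1 {n})

bit : Bool → ℕ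
bit b = if b then 1 else 0

ΣN-δ : ∀ {n} (i : Fin n) → ΣN (λ k → bit (does (i ≟ k))) ≡ 1
ΣN-δ {suc n} zero    = cong suc (ΣN-0 {n})
ΣN-δ {suc n} (suc i) = ΣN-δ i

Matrix : ℕ → ℕ → Set
Matrix k m = Fin k → Fin m → Bool

infixl 6 _⊕_
infixl 7 _∩_
infixl 7 _ᵛ*_ _*ᵛ_

_⊕_ : ∀ {n} → BVec n → BVec n → BVec n
(x ⊕ y) j = x j xor y j

_∩_ : ∀ {n} → BVec n → BVec n → BVec n
(x ∩ y) j = x j ∧ y j

_ᵛ*_ : ∀ {k m} → BVec k → Matrix k m → BVec m
(c ᵛ* G) j = ⊕Σ (λ i → c i ∧ G i j)

_*ᵛ_ : ∀ {k m} → Matrix k m → BVec m → BVec k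
(G *ᵛ e) i = dot (G i) e

dot-comm : ∀ {n} (x y : BVec n) → dot x y ≡ dot y x
dot-comm x y = ⊕Σ-cong (λ j → ∧-comm (x j) (y j))

dot-ᵛ* : ∀ {k m} (c : BVec k) (G : Matrix k m) (e : BVec m) → dot (c ᵛ* G) e ≡ dot c (G *ᵛ e)
dot-ᵛ* c G e = begin
  ⊕Σ (λ j → ⊕Σ (λ i → c i ∧ G i j) ∧ e j)     ≡⟨ ⊕Σ-cong (λ j → ∧-distribʳ-⊕Σ (e j) (λ i → c i ∧ G i j)) ⟩
  ⊕Σ (λ j → ⊕Σ (λ i → (c i ∧ G i j) ∧ e j))   ≡⟨ ⊕Σ-cong (λ j → ⊕Σ-cong (λ i → ∧-assoc (c i) (G i j) (e j))) ⟩
  ⊕Σ (λ j → ⊕Σ (λ i → c i ∧ (G i j ∧ e j)))   ≡⟨ ⊕Σ-comm (λ j i → c i ∧ (G i j ∧ e j)) ⟩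
  ⊕Σ (λ i → ⊕Σ (λ j → c i ∧ (G i j ∧ e j)))   ≡⟨ ⊕Σ-cong (λ i → sym (∧-distribˡ-⊕Σ (c i) (λ j → G i j ∧ e j))) ⟩
  ⊕Σ (λ i → c i ∧ dot (G i) e)                ∎

dot-cong : ∀ {n} {x x' y y' : BVec n} → (∀ j → x j ≡ x' j) → (∀ j → y j ≡ y' j) → dot x y ≡ dot x' y'
dot-cong x≗x' y≗y' = ⊕Σ-cong (λ j → cong₂ _∧_ (x≗x' j) (y≗y' j))

dot-splitAt : ∀ m {n} (x y : BVec (m + n))
  → dot x y ≡ dot (λ k → x (k ↑ˡ n)) (λ k → y (k ↑ˡ n)) xor dot (λ k → x (m ↑ʳ k)) (λ k → y (m ↑ʳ k))
dot-splitAt m x y = ⊕Σ-splitAt m (x ∩ y)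

ᵛ*∈C : ∀ {k m} (G : Matrix k m) (c : BVec k) → C G (c ᵛ* G)
ᵛ*∈C G c = c , λ _ → refl

row∈C : ∀ {k m} (G : Matrix k m) (i : Fin k) → C G (G i)
row∈C G i = (λ l → does (i ≟ l)) , λ j → sym (⊕Σ-δˡ i (λ l → G l j))

wt-cong : ∀ {n} {x y : BVec n} → (∀ i → x i ≡ y i) → wt x ≡ wt y
wt-cong x≗y = ΣN-cong (cong bit ∘ x≗y)

wt-zero : ∀ {n} {x : BVec n} → (∀ i → x i ≡ false) → wt x ≡ 0
wt-zero {n} x≗0 = trans (wt-cong x≗0) (ΣN-0 {n})


wt-⊕ : ∀ {n} (x y : BVec n) → wt (x ⊕ y) + 2 * wt (x ∩ y) ≡ wt x + wt y
wt-⊕ {zero}  x y = refl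
wt-⊕ {suc n} x y = begin
  (bit (x₀ xor y₀) + wt (x' ⊕ y')) + 2 * (bit (x₀ ∧ y₀) + wt (x' ∩ y'))
    ≡⟨ regroup (bit (x₀ xor y₀)) (wt (x' ⊕ y')) (bit (x₀ ∧ y₀)) (wt (x' ∩ y')) ⟩
  (bit (x₀ xor y₀) + 2 * bit (x₀ ∧ y₀)) + (wt (x' ⊕ y') + 2 * wt (x' ∩ y'))
    ≡⟨ cong₂ _+_ (bitHalfAdder x₀ y₀) (wt-⊕ x' y') ⟩
  (bit x₀ + bit y₀) + (wt x' + wt y')
    ≡⟨ interchange (bit x₀) (bit y₀) (wt x') (wt y') ⟩
  (bit x₀ + wt x') + (bit y₀ + wt y')
    ∎
  where
  x₀ = x zero
  y₀ = y zero
  x' = x ∘ suc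
  y' = y ∘ suc
  bitHalfAdder : ∀ a b → bit (a xor b) + 2 * bit (a ∧ b) ≡ bit a + bit b
  bitHalfAdder true  true  = refl
  bitHalfAdder true  false = refl
  bitHalfAdder false true  = refl
  bitHalfAdder false false = refl
  regroup : ∀ a b c d → (a + b) + 2 * (c + d) ≡ (a + 2 * c) + (b + 2 * d)
  regroup = solve-∀
  interchange : ∀ a b c d → (a + b) + (c + d) ≡ (a + c) + (b + d)
  interchange = solve-∀

ω^[2*wt∩] : ∀ {n} (x y : BVec n) → ω ^₅ (2 * wt (x ∩ y)) ≡ sign (dot x y)
ω^[2*wt∩] {zero}  x y = refl
ω^[2*wt∩] {suc n} x y = begin
  ω ^₅ (2 * (bit (x zero ∧ y zero) + wt (x' ∩ y')))
    ≡⟨ cong (ω ^₅_) (*-distribˡ-+ 2 (bit (x zero ∧ y zero)) (wt (x' ∩ y'))) ⟩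
  ω ^₅ (2 * bit (x zero ∧ y zero) + 2 * wt (x' ∩ y'))
    ≡⟨ ^₅-distribˡ-+ ω (2 * bit (x zero ∧ y zero)) _ ⟩
  ω ^₅ (2 * bit (x zero ∧ y zero)) *₅ ω ^₅ (2 * wt (x' ∩ y'))
    ≡⟨ cong₂ _*₅_ (ω^[2*bit] (x zero ∧ y zero)) (ω^[2*wt∩] x' y') ⟩
  sign (x zero ∧ y zero) *₅ sign (dot x' y')
    ≡⟨ sym (sign-xor (x zero ∧ y zero) (dot x' y')) ⟩
  sign (dot x y)
    ∎
  where
  x' = x ∘ suc
  y' = y ∘ suc
  ω^[2*bit] : ∀ b → ω ^₅ (2 * bit b) ≡ sign b
  ω^[2*bit] true  = refl
  ω^[2*bit] false = refl

ω^wt-⊕ : ∀ {n} (x y : BVec n) → ω ^₅ wt (x ⊕ y) *₅ sign (dot x y) ≡ ω ^₅ wt x *₅ ω ^₅ wt y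
ω^wt-⊕ x y = begin
  ω ^₅ wt (x ⊕ y) *₅ sign (dot x y)          ≡⟨ cong (ω ^₅ wt (x ⊕ y) *₅_) (sym (ω^[2*wt∩] x y)) ⟩
  ω ^₅ wt (x ⊕ y) *₅ ω ^₅ (2 * wt (x ∩ y))   ≡⟨ sym (^₅-distribˡ-+ ω (wt (x ⊕ y)) _) ⟩
  ω ^₅ (wt (x ⊕ y) + 2 * wt (x ∩ y))         ≡⟨ cong (ω ^₅_) (wt-⊕ x y) ⟩
  ω ^₅ (wt x + wt y)                         ≡⟨ ^₅-distribˡ-+ ω (wt x) (wt y) ⟩
  ω ^₅ wt x *₅ ω ^₅ wt y                     ∎

doublyEven-⊕ : ∀ {n} {x y : BVec n} → dot x y ≡ false → 4 ∣ wt x → 4 ∣ wt y → 4 ∣ wt (x ⊕ y)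
doublyEven-⊕ {x = x} {y} x⊥y 4∣x 4∣y = ω^≡1⇒4∣ (wt (x ⊕ y)) (begin
  ω ^₅ wt (x ⊕ y)                     ≡⟨ sym (*₅-identityʳ _) ⟩
  ω ^₅ wt (x ⊕ y) *₅ sign false       ≡⟨ cong (λ b → ω ^₅ wt (x ⊕ y) *₅ sign b) (sym x⊥y) ⟩
  ω ^₅ wt (x ⊕ y) *₅ sign (dot x y)   ≡⟨ ω^wt-⊕ x y ⟩
  ω ^₅ wt x *₅ ω ^₅ wt y              ≡⟨ cong₂ _*₅_ (4∣⇒ω^≡1 4∣x) (4∣⇒ω^≡1 4∣y) ⟩
  # 1                                 ∎)

span-doublyEven : ∀ {k m} (G : Matrix k m) → (∀ i j → dot (G i) (G j) ≡ false) → (∀ i → 4 ∣ wt (G i))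
  → ∀ c → 4 ∣ wt (c ᵛ* G)
span-doublyEven {zero} {m} G _ _ c = subst (4 ∣_) (sym (ΣN-0 {m})) (4 ∣0)
span-doublyEven {suc k} G orth 4∣G c = withHead (c zero)
  where
  c' = c ∘ suc
  G' = G ∘ suc
  rest : 4 ∣ wt (c' ᵛ* G')
  rest = span-doublyEven G' (λ i j → orth (suc i) (suc j)) (4∣G ∘ suc) c'
  head⊥rest : dot (G zero) (c' ᵛ* G') ≡ false
  head⊥rest = begin
    dot (G zero) (c' ᵛ* G')   ≡⟨ dot-comm (G zero) _ ⟩
    dot (c' ᵛ* G') (G zero)   ≡⟨ dot-ᵛ* c' G' (G zero) ⟩
    ⊕Σ (λ i → c' i ∧ dot (G' i) (G zero)) ≡⟨ ⊕Σ-zero (λ i → trans (cong (c' i ∧_) (orth (suc i) zero)) (∧-zeroʳ (c' i))) ⟩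
    false                                ∎
  withHead : ∀ b → 4 ∣ wt (λ j → (b ∧ G zero j) xor (c' ᵛ* G') j)
  withHead false = rest
  withHead true  = doublyEven-⊕ {x = G zero} head⊥rest (4∣G zero) rest

-- Character sums over F₂ⁿ

∑ : ∀ {n} → (BVec n → F₅) → F₅
∑ {zero}  f = f []
∑ {suc n} f = ∑ (λ v → f (false ∷ v)) +₅ ∑ (λ v → f (true ∷ v))

∑-cong : ∀ {n} {f g : BVec n → F₅} → (∀ v → f v ≡ g v) → ∑ f ≡ ∑ g
∑-cong {zero}  f≗g = f≗g []
∑-cong {suc n} f≗g = cong₂ _+₅_ (∑-cong (f≗g ∘ (false ∷_))) (∑-cong (f≗g ∘ (true ∷_)))

∑-+₅ : ∀ {n} (f g : BVec n → F₅) → ∑ (λ v → f v +₅ g v) ≡ ∑ f +₅ ∑ g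
∑-+₅ {zero}  f g = refl
∑-+₅ {suc n} f g = trans
  (cong₂ _+₅_ (∑-+₅ (f ∘ (false ∷_)) (g ∘ (false ∷_))) (∑-+₅ (f ∘ (true ∷_)) (g ∘ (true ∷_))))
  (+₅-interchange (∑ (f ∘ (false ∷_))) (∑ (g ∘ (false ∷_))) (∑ (f ∘ (true ∷_))) (∑ (g ∘ (true ∷_))))

*₅-distribˡ-∑ : ∀ {n} a (f : BVec n → F₅) → ∑ (λ v → a *₅ f v) ≡ a *₅ ∑ f
*₅-distribˡ-∑ {zero}  a f = refl
*₅-distribˡ-∑ {suc n} a f = trans
  (cong₂ _+₅_ (*₅-distribˡ-∑ a (f ∘ (false ∷_))) (*₅-distribˡ-∑ a (f ∘ (true ∷_))))
  (sym (*₅-distribˡ-+₅ a (∑ (f ∘ (false ∷_))) (∑ (f ∘ (true ∷_)))))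

∑-comm : ∀ {m n} (f : BVec m → BVec n → F₅) → ∑ (λ u → ∑ (f u)) ≡ ∑ (λ v → ∑ (λ u → f u v))
∑-comm {zero}  f = refl
∑-comm {suc m} f = trans
  (cong₂ _+₅_ (∑-comm (f ∘ (false ∷_))) (∑-comm (f ∘ (true ∷_))))
  (sym (∑-+₅ (λ v → ∑ (λ u → f (false ∷ u) v)) (λ v → ∑ (λ u → f (true ∷ u) v))))

∑-ω^wt⊕ : ∀ {n} (x : BVec n) → ∑ (λ e → ω ^₅ wt (x ⊕ e)) ≡ # 3 ^₅ n
∑-ω^wt⊕ {zero}  x = refl
∑-ω^wt⊕ {suc n} x = begin
  ∑ (λ v → ω ^₅ (bit (x zero xor false) + wt (x' ⊕ v))) +₅ ∑ (λ v → ω ^₅ (bit (x zero xor true) + wt (x' ⊕ v)))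
    ≡⟨ cong₂ _+₅_ (factorHead false) (factorHead true) ⟩
  ω ^₅ bit (x zero xor false) *₅ # 3 ^₅ n +₅ ω ^₅ bit (x zero xor true) *₅ # 3 ^₅ n
    ≡⟨ sym (*₅-distribʳ-+₅ (ω ^₅ bit (x zero xor false)) _ _) ⟩
  (ω ^₅ bit (x zero xor false) +₅ ω ^₅ bit (x zero xor true)) *₅ # 3 ^₅ n
    ≡⟨ cong (_*₅ # 3 ^₅ n) (bothBits (x zero)) ⟩
  # 3 ^₅ suc n
    ∎
  where
  x' = x ∘ suc
  factorHead : ∀ b → ∑ (λ v → ω ^₅ (bit (x zero xor b) + wt (x' ⊕ v))) ≡ ω ^₅ bit (x zero xor b) *₅ # 3 ^₅ n
  factorHead b = begin
    ∑ (λ v → ω ^₅ (bit (x zero xor b) + wt (x' ⊕ v)))       ≡⟨ ∑-cong (λ v → ^₅-distribˡ-+ ω (bit (x zero xor b)) (wt (x' ⊕ v))) ⟩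
    ∑ (λ v → ω ^₅ bit (x zero xor b) *₅ ω ^₅ wt (x' ⊕ v))   ≡⟨ *₅-distribˡ-∑ (ω ^₅ bit (x zero xor b)) (λ v → ω ^₅ wt (x' ⊕ v)) ⟩
    ω ^₅ bit (x zero xor b) *₅ ∑ (λ v → ω ^₅ wt (x' ⊕ v))   ≡⟨ cong (ω ^₅ bit (x zero xor b) *₅_) (∑-ω^wt⊕ x') ⟩
    ω ^₅ bit (x zero xor b) *₅ # 3 ^₅ n                     ∎
  bothBits : ∀ a → ω ^₅ bit (a xor false) +₅ ω ^₅ bit (a xor true) ≡ # 3
  bothBits true  = refl
  bothBits false = refl

2ⁿ[_≡𝟘] : ∀ {n} → BVec n → F₅
2ⁿ[_≡𝟘] {zero}  w = # 1
2ⁿ[_≡𝟘] {suc n} w = (if w zero then # 0 else ω) *₅ 2ⁿ[ w ∘ suc ≡𝟘]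

2ⁿ[𝟘≡𝟘] : ∀ {n} {w : BVec n} → (∀ i → w i ≡ false) → 2ⁿ[ w ≡𝟘] ≡ ω ^₅ n
2ⁿ[𝟘≡𝟘] {zero}  w≗0 = refl
2ⁿ[𝟘≡𝟘] {suc n} {w} w≗0 rewrite w≗0 zero = cong (ω *₅_) (2ⁿ[𝟘≡𝟘] (w≗0 ∘ suc))

2ⁿ[≢𝟘] : ∀ {n} {w : BVec n} → ¬ (∀ i → w i ≡ false) → 2ⁿ[ w ≡𝟘] ≡ # 0
2ⁿ[≢𝟘] {zero}      w≢0 = contradiction (λ ()) w≢0
2ⁿ[≢𝟘] {suc n} {w} w≢0 with w zero in w₀≡
... | true  = *₅-zeroˡ 2ⁿ[ w ∘ suc ≡𝟘]
... | false = trans (cong (ω *₅_) (2ⁿ[≢𝟘] w'≢0)) (*₅-zeroʳ ω)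
  where
  w'≢0 : ¬ (∀ i → w (suc i) ≡ false)
  w'≢0 w'≗0 = w≢0 λ { zero → w₀≡ ; (suc i) → w'≗0 i }

∑-2ⁿ[≡𝟘] : ∀ {n} → ∑ (2ⁿ[_≡𝟘] {n}) ≡ ω ^₅ n
∑-2ⁿ[≡𝟘] {zero}  = refl
∑-2ⁿ[≡𝟘] {suc n} = begin
  ∑ (λ v → ω *₅ z v) +₅ ∑ (λ v → # 0 *₅ z v)   ≡⟨ cong₂ _+₅_ (*₅-distribˡ-∑ ω z) (*₅-distribˡ-∑ (# 0) z) ⟩
  ω *₅ ∑ z +₅ # 0 *₅ ∑ z                       ≡⟨ cong₂ _+₅_ (cong (ω *₅_) (∑-2ⁿ[≡𝟘] {n})) (*₅-zeroˡ (∑ z)) ⟩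
  ω *₅ ω ^₅ n +₅ # 0                           ≡⟨ +₅-identityʳ _ ⟩
  ω ^₅ suc n                                   ∎
  where z = 2ⁿ[_≡𝟘] {n}

∑-sign-dot : ∀ {n} (w : BVec n) → ∑ (λ c → sign (dot c w)) ≡ 2ⁿ[ w ≡𝟘]
∑-sign-dot {zero}  w = refl
∑-sign-dot {suc n} w = begin
  ∑ (λ v → sign ((false ∧ w zero) xor dot v w')) +₅ ∑ (λ v → sign ((true ∧ w zero) xor dot v w'))
    ≡⟨ cong₂ _+₅_ (factorHead false) (factorHead true) ⟩
  sign false *₅ 2ⁿ[ w' ≡𝟘] +₅ sign (w zero) *₅ 2ⁿ[ w' ≡𝟘]
    ≡⟨ sym (*₅-distribʳ-+₅ (sign false) (sign (w zero)) _) ⟩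
  (sign false +₅ sign (w zero)) *₅ 2ⁿ[ w' ≡𝟘]
    ≡⟨ cong (_*₅ 2ⁿ[ w' ≡𝟘]) (1+sign (w zero)) ⟩
  2ⁿ[ w ≡𝟘]
    ∎
  where
  w' = w ∘ suc
  factorHead : ∀ b → ∑ (λ v → sign ((b ∧ w zero) xor dot v w')) ≡ sign (b ∧ w zero) *₅ 2ⁿ[ w' ≡𝟘]
  factorHead b = begin
    ∑ (λ v → sign ((b ∧ w zero) xor dot v w'))       ≡⟨ ∑-cong (λ v → sign-xor (b ∧ w zero) (dot v w')) ⟩
    ∑ (λ v → sign (b ∧ w zero) *₅ sign (dot v w'))   ≡⟨ *₅-distribˡ-∑ (sign (b ∧ w zero)) (λ v → sign (dot v w')) ⟩
    sign (b ∧ w zero) *₅ ∑ (λ v → sign (dot v w'))   ≡⟨ cong (sign (b ∧ w zero) *₅_) (∑-sign-dot w') ⟩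
    sign (b ∧ w zero) *₅ 2ⁿ[ w' ≡𝟘]                  ∎
  1+sign : ∀ b → sign false +₅ sign b ≡ (if b then # 0 else ω)
  1+sign true  = refl
  1+sign false = refl

-- The codes C([I | A])

Symmetric : ∀ {n} → Matrix n n → Set
Symmetric A = ∀ i j → A i j ≡ A j i

Orthogonal : ∀ {n} → Matrix n n → Set
Orthogonal A = ∀ i j → dot (A i) (A j) ≡ does (i ≟ j)

module _ {N : ℕ} (A : Matrix N N) where

  IA-↑ˡ : ∀ i k → IA A i (k ↑ˡ N) ≡ does (i ≟ k)
  IA-↑ˡ i k rewrite splitAt-↑ˡ N k N = refl

  IA-↑ʳ : ∀ i k → IA A i (N ↑ʳ k) ≡ A i k
  IA-↑ʳ i k rewrite splitAt-↑ʳ N N k = refl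

  ᵛ*IA-↑ˡ : ∀ c k → (c ᵛ* IA A) (k ↑ˡ N) ≡ c k
  ᵛ*IA-↑ˡ c k = trans (⊕Σ-cong (λ i → cong (c i ∧_) (IA-↑ˡ i k))) (⊕Σ-δʳ k c)

  ᵛ*IA-↑ʳ : ∀ c k → (c ᵛ* IA A) (N ↑ʳ k) ≡ (c ᵛ* A) k
  ᵛ*IA-↑ʳ c k = ⊕Σ-cong (λ i → cong (c i ∧_) (IA-↑ʳ i k))

  wt-ᵛ*IA : ∀ c → wt (c ᵛ* IA A) ≡ wt c + wt (c ᵛ* A)
  wt-ᵛ*IA c = trans (ΣN-splitAt N (bit ∘ (c ᵛ* IA A)))
    (cong₂ _+_ (ΣN-cong (cong bit ∘ ᵛ*IA-↑ˡ c)) (ΣN-cong (cong bit ∘ ᵛ*IA-↑ʳ c)))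

  wt-IA : ∀ i → wt (IA A i) ≡ suc (wt (A i))
  wt-IA i = trans (ΣN-splitAt N (bit ∘ IA A i))
    (cong₂ _+_ (trans (ΣN-cong (cong bit ∘ IA-↑ˡ i)) (ΣN-δ i)) (ΣN-cong (cong bit ∘ IA-↑ʳ i)))

  dot-IA : ∀ i j → dot (IA A i) (IA A j) ≡ does (i ≟ j) xor dot (A i) (A j)
  dot-IA i j = begin
    dot (IA A i) (IA A j)
      ≡⟨ dot-splitAt N (IA A i) (IA A j) ⟩
    dot (λ k → IA A i (k ↑ˡ N)) (λ k → IA A j (k ↑ˡ N)) xor dot (λ k → IA A i (N ↑ʳ k)) (λ k → IA A j (N ↑ʳ k))
      ≡⟨ cong₂ _xor_ (dot-cong (IA-↑ˡ i) (IA-↑ˡ j)) (dot-cong (IA-↑ʳ i) (IA-↑ʳ j)) ⟩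
    ⊕Σ (λ k → does (i ≟ k) ∧ does (j ≟ k)) xor dot (A i) (A j)
      ≡⟨ cong (_xor dot (A i) (A j)) (trans (⊕Σ-δˡ i (λ k → does (j ≟ k))) (does-≟-sym j i)) ⟩
    does (i ≟ j) xor dot (A i) (A j)
      ∎

  dot-ᵛ*IA : ∀ c' c → dot (c' ᵛ* IA A) (c ᵛ* IA A) ≡ dot c' c xor dot (c' ᵛ* A) (c ᵛ* A)
  dot-ᵛ*IA c' c = trans (dot-splitAt N (c' ᵛ* IA A) (c ᵛ* IA A))
    (cong₂ _xor_ (dot-cong (ᵛ*IA-↑ˡ c') (ᵛ*IA-↑ˡ c)) (dot-cong (ᵛ*IA-↑ʳ c') (ᵛ*IA-↑ʳ c)))

  selfDual⇒rows⊥ : SelfDual (C (IA A)) → ∀ i j → dot (IA A i) (IA A j) ≡ false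
  selfDual⇒rows⊥ sd i j = proj₁ (sd (IA A j)) (row∈C (IA A) j) (IA A i) (row∈C (IA A) i)

  selfDual⇒orthogonal : SelfDual (C (IA A)) → Orthogonal A
  selfDual⇒orthogonal sd i j = xor≡false⇒≡ (trans (sym (dot-IA i j)) (selfDual⇒rows⊥ sd i j))

  doublyEven⇔rows : SelfDual (C (IA A)) → DoublyEven (C (IA A)) ⇔ (∀ i → 4 ∣ suc (wt (A i)))
  doublyEven⇔rows sd = mk⇔ rowsOf spanOf
    where
    rowsOf : DoublyEven (C (IA A)) → ∀ i → 4 ∣ suc (wt (A i))
    rowsOf de i = subst (4 ∣_) (wt-IA i) (de (IA A i) (row∈C (IA A) i))
    spanOf : (∀ i → 4 ∣ suc (wt (A i))) → DoublyEven (C (IA A))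
    spanOf rows x (c , x≗cG) = subst (4 ∣_) (sym (wt-cong x≗cG))
      (span-doublyEven (IA A) (selfDual⇒rows⊥ sd) (λ i → subst (4 ∣_) (sym (wt-IA i)) (rows i)) c)

  gaussSum : F₅
  gaussSum = ∑ (λ c → ∑ (λ e → ω ^₅ (wt c + wt (c ᵛ* A ⊕ e))))

  gaussSum≡4ⁿ : gaussSum ≡ (ω *₅ ω) ^₅ N
  gaussSum≡4ⁿ = begin
    gaussSum                                     ≡⟨ ∑-cong inner ⟩
    ∑ (λ (c : BVec N) → # 3 ^₅ N *₅ ω ^₅ wt c)   ≡⟨ *₅-distribˡ-∑ (# 3 ^₅ N) (λ (c : BVec N) → ω ^₅ wt c) ⟩
    # 3 ^₅ N *₅ ∑ (λ (c : BVec N) → ω ^₅ wt c)   ≡⟨ cong (# 3 ^₅ N *₅_) (∑-ω^wt⊕ {N} (λ _ → false)) ⟩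
    # 3 ^₅ N *₅ # 3 ^₅ N                         ≡⟨ sym (^₅-distribʳ-*₅ (# 3) (# 3) N) ⟩
    (ω *₅ ω) ^₅ N                                ∎
    where
    inner : ∀ c → ∑ (λ e → ω ^₅ (wt c + wt (c ᵛ* A ⊕ e))) ≡ # 3 ^₅ N *₅ ω ^₅ wt c
    inner c = begin
      ∑ (λ e → ω ^₅ (wt c + wt (c ᵛ* A ⊕ e)))       ≡⟨ ∑-cong (λ e → ^₅-distribˡ-+ ω (wt c) (wt (c ᵛ* A ⊕ e))) ⟩
      ∑ (λ e → ω ^₅ wt c *₅ ω ^₅ wt (c ᵛ* A ⊕ e))   ≡⟨ *₅-distribˡ-∑ (ω ^₅ wt c) (λ e → ω ^₅ wt (c ᵛ* A ⊕ e)) ⟩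
      ω ^₅ wt c *₅ ∑ (λ e → ω ^₅ wt (c ᵛ* A ⊕ e))   ≡⟨ cong (ω ^₅ wt c *₅_) (∑-ω^wt⊕ (c ᵛ* A)) ⟩
      ω ^₅ wt c *₅ # 3 ^₅ N                         ≡⟨ *₅-comm (ω ^₅ wt c) (# 3 ^₅ N) ⟩
      # 3 ^₅ N *₅ ω ^₅ wt c                         ∎

  ω^wt-ᵛ*⊕ : DoublyEven (C (IA A)) → ∀ c e → ω ^₅ (wt c + wt (c ᵛ* A ⊕ e)) ≡ ω ^₅ wt e *₅ sign (dot c (A *ᵛ e))
  ω^wt-ᵛ*⊕ de c e = *₅-sign-cancel (dot c (A *ᵛ e)) (begin
    ω ^₅ (wt c + wt (c ᵛ* A ⊕ e)) *₅ sign (dot c (A *ᵛ e))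
      ≡⟨ cong₂ _*₅_ (^₅-distribˡ-+ ω (wt c) _) (cong sign (sym (dot-ᵛ* c A e))) ⟩
    ω ^₅ wt c *₅ ω ^₅ wt (c ᵛ* A ⊕ e) *₅ sign (dot (c ᵛ* A) e)
      ≡⟨ *₅-assoc (ω ^₅ wt c) _ _ ⟩
    ω ^₅ wt c *₅ (ω ^₅ wt (c ᵛ* A ⊕ e) *₅ sign (dot (c ᵛ* A) e))
      ≡⟨ cong (ω ^₅ wt c *₅_) (ω^wt-⊕ (c ᵛ* A) e) ⟩
    ω ^₅ wt c *₅ (ω ^₅ wt (c ᵛ* A) *₅ ω ^₅ wt e)
      ≡⟨ sym (*₅-assoc (ω ^₅ wt c) _ _) ⟩
    ω ^₅ wt c *₅ ω ^₅ wt (c ᵛ* A) *₅ ω ^₅ wt e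
      ≡⟨ cong (_*₅ ω ^₅ wt e) (sym (^₅-distribˡ-+ ω (wt c) (wt (c ᵛ* A)))) ⟩
    ω ^₅ (wt c + wt (c ᵛ* A)) *₅ ω ^₅ wt e
      ≡⟨ cong (_*₅ ω ^₅ wt e) (4∣⇒ω^≡1 (subst (4 ∣_) (wt-ᵛ*IA c) (de _ (ᵛ*∈C (IA A) c)))) ⟩
    # 1 *₅ ω ^₅ wt e
      ≡⟨ *₅-identityˡ (ω ^₅ wt e) ⟩
    ω ^₅ wt e
      ∎)

  module _ (symA : Symmetric A) (orthA : Orthogonal A) where

    *ᵛ-ᵛ* : ∀ c i → (A *ᵛ (c ᵛ* A)) i ≡ c i
    *ᵛ-ᵛ* c i = begin
      dot (A i) (c ᵛ* A)                 ≡⟨ dot-comm (A i) (c ᵛ* A) ⟩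
      dot (c ᵛ* A) (A i)                 ≡⟨ dot-ᵛ* c A (A i) ⟩
      ⊕Σ (λ l → c l ∧ dot (A l) (A i))   ≡⟨ ⊕Σ-cong (λ l → cong (c l ∧_) (orthA l i)) ⟩
      ⊕Σ (λ l → c l ∧ does (l ≟ i))      ≡⟨ ⊕Σ-δʳ i c ⟩
      c i                                ∎

    ᵛ*≗*ᵛ : ∀ c k → (c ᵛ* A) k ≡ (A *ᵛ c) k
    ᵛ*≗*ᵛ c k = ⊕Σ-cong (λ i → trans (∧-comm (c i) (A i k)) (cong (_∧ c i) (symA i k)))

    ᵛ*-*ᵛ : ∀ e k → ((A *ᵛ e) ᵛ* A) k ≡ e k
    ᵛ*-*ᵛ e k = begin
      ((A *ᵛ e) ᵛ* A) k    ≡⟨ ᵛ*≗*ᵛ (A *ᵛ e) k ⟩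
      dot (A k) (A *ᵛ e)   ≡⟨ dot-cong (λ _ → refl) (λ i → sym (ᵛ*≗*ᵛ e i)) ⟩
      dot (A k) (e ᵛ* A)   ≡⟨ *ᵛ-ᵛ* e k ⟩
      e k                  ∎

    ∈C⇒∈C⊥ : ∀ {y} → C (IA A) y → (C (IA A) ⊥) y
    ∈C⇒∈C⊥ {y} (c , y≗cG) x (c' , x≗c'G) = begin
      dot x y                               ≡⟨ dot-cong x≗c'G y≗cG ⟩
      dot (c' ᵛ* IA A) (c ᵛ* IA A)          ≡⟨ dot-ᵛ*IA c' c ⟩
      dot c' c xor dot (c' ᵛ* A) (c ᵛ* A)   ≡⟨ cong (dot c' c xor_) (dot-ᵛ* c' A (c ᵛ* A)) ⟩
      dot c' c xor dot c' (A *ᵛ (c ᵛ* A))   ≡⟨ cong (dot c' c xor_) (dot-cong (λ _ → refl) (*ᵛ-ᵛ* c)) ⟩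
      dot c' c xor dot c' c                 ≡⟨ xor-same (dot c' c) ⟩
      false                                 ∎

    ∈C⊥⇒∈C : ∀ {y} → (C (IA A) ⊥) y → C (IA A) y
    ∈C⊥⇒∈C {y} y⊥C = u , y≗uG
      where
      u v : BVec N
      u k = y (k ↑ˡ N)
      v k = y (N ↑ʳ k)
      u≗Av : ∀ i → u i ≡ (A *ᵛ v) i
      u≗Av i = xor≡false⇒≡ (begin
        (A *ᵛ v) i xor u i
          ≡⟨ xor-comm ((A *ᵛ v) i) (u i) ⟩
        u i xor dot (A i) v
          ≡⟨ cong₂ _xor_ (sym (trans (dot-cong (IA-↑ˡ i) (λ _ → refl)) (⊕Σ-δˡ i u)))
                         (sym (dot-cong (IA-↑ʳ i) (λ _ → refl))) ⟩
        dot (λ k → IA A i (k ↑ˡ N)) u xor dot (λ k → IA A i (N ↑ʳ k)) v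
          ≡⟨ sym (dot-splitAt N (IA A i) y) ⟩
        dot (IA A i) y
          ≡⟨ y⊥C (IA A i) (row∈C (IA A) i) ⟩
        false
          ∎)
      y≗uG : ∀ j → y j ≡ (u ᵛ* IA A) j
      y≗uG j with ↑-view N j
      ... | inj₁ (k , refl) = sym (ᵛ*IA-↑ˡ u k)
      ... | inj₂ (k , refl) = sym (begin
        (u ᵛ* IA A) (N ↑ʳ k)   ≡⟨ ᵛ*IA-↑ʳ u k ⟩
        (u ᵛ* A) k             ≡⟨ ⊕Σ-cong (λ i → cong (_∧ A i k) (u≗Av i)) ⟩
        ((A *ᵛ v) ᵛ* A) k      ≡⟨ ᵛ*-*ᵛ v k ⟩
        v k                    ∎)

    symmetric-orthogonal⇒selfDual : SelfDual (C (IA A))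
    symmetric-orthogonal⇒selfDual y = ∈C⇒∈C⊥ , ∈C⊥⇒∈C

    ω^wt*2ⁿ[A*ᵛ≡𝟘] : ∀ e → ω ^₅ wt e *₅ 2ⁿ[ A *ᵛ e ≡𝟘] ≡ 2ⁿ[ e ≡𝟘]
    ω^wt*2ⁿ[A*ᵛ≡𝟘] e with all? (λ i → e i ≟ᴮ false)
    ... | yes e≗0 = begin
      ω ^₅ wt e *₅ 2ⁿ[ A *ᵛ e ≡𝟘]   ≡⟨ cong₂ _*₅_ (cong (ω ^₅_) (wt-zero e≗0)) (2ⁿ[𝟘≡𝟘] Ae≗0) ⟩
      # 1 *₅ ω ^₅ N                 ≡⟨ *₅-identityˡ (ω ^₅ N) ⟩
      ω ^₅ N                        ≡⟨ sym (2ⁿ[𝟘≡𝟘] e≗0) ⟩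
      2ⁿ[ e ≡𝟘]                     ∎
      where
      Ae≗0 : ∀ i → (A *ᵛ e) i ≡ false
      Ae≗0 i = ⊕Σ-zero (λ k → trans (cong (A i k ∧_) (e≗0 k)) (∧-zeroʳ (A i k)))
    ... | no e≢0 = begin
      ω ^₅ wt e *₅ 2ⁿ[ A *ᵛ e ≡𝟘]   ≡⟨ cong (ω ^₅ wt e *₅_) (2ⁿ[≢𝟘] Ae≢0) ⟩
      ω ^₅ wt e *₅ # 0              ≡⟨ *₅-zeroʳ (ω ^₅ wt e) ⟩
      # 0                           ≡⟨ sym (2ⁿ[≢𝟘] e≢0) ⟩
      2ⁿ[ e ≡𝟘]                     ∎
      where
      Ae≢0 : ¬ (∀ i → (A *ᵛ e) i ≡ false)
      Ae≢0 Ae≗0 = e≢0 (λ k → trans (sym (ᵛ*-*ᵛ e k)) (⊕Σ-zero (λ i → cong (_∧ A i k) (Ae≗0 i))))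

    gaussSum≡2ⁿ : DoublyEven (C (IA A)) → gaussSum ≡ ω ^₅ N
    gaussSum≡2ⁿ de = begin
      ∑ (λ c → ∑ (λ e → ω ^₅ (wt c + wt (c ᵛ* A ⊕ e))))   ≡⟨ ∑-comm (λ c e → ω ^₅ (wt c + wt (c ᵛ* A ⊕ e))) ⟩
      ∑ (λ e → ∑ (λ c → ω ^₅ (wt c + wt (c ᵛ* A ⊕ e))))   ≡⟨ ∑-cong inner ⟩
      ∑ (2ⁿ[_≡𝟘] {N})                                     ≡⟨ ∑-2ⁿ[≡𝟘] {N} ⟩
      ω ^₅ N                                              ∎
      where
      inner : ∀ e → ∑ (λ c → ω ^₅ (wt c + wt (c ᵛ* A ⊕ e))) ≡ 2ⁿ[ e ≡𝟘]
      inner e = begin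
        ∑ (λ c → ω ^₅ (wt c + wt (c ᵛ* A ⊕ e)))        ≡⟨ ∑-cong (λ c → ω^wt-ᵛ*⊕ de c e) ⟩
        ∑ (λ c → ω ^₅ wt e *₅ sign (dot c (A *ᵛ e)))   ≡⟨ *₅-distribˡ-∑ (ω ^₅ wt e) (λ c → sign (dot c (A *ᵛ e))) ⟩
        ω ^₅ wt e *₅ ∑ (λ c → sign (dot c (A *ᵛ e)))   ≡⟨ cong (ω ^₅ wt e *₅_) (∑-sign-dot (A *ᵛ e)) ⟩
        ω ^₅ wt e *₅ 2ⁿ[ A *ᵛ e ≡𝟘]                    ≡⟨ ω^wt*2ⁿ[A*ᵛ≡𝟘] e ⟩
        2ⁿ[ e ≡𝟘]                                      ∎

    doublyEven⇒4∣ : DoublyEven (C (IA A)) → 4 ∣ N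
    doublyEven⇒4∣ de = [ω*ω]^≡ω^⇒4∣ N (trans (sym gaussSum≡4ⁿ) (gaussSum≡2ⁿ de))

-- Graphs and their joins

handshake : ∀ {n} (A : Matrix n n) → Symmetric A → (∀ i → A i i ≡ false) → ⊕Σ (λ i → ⊕Σ (A i)) ≡ false
handshake {zero}  A symA irrefl = refl
handshake {suc n} A symA irrefl = begin
  (A zero zero xor r) xor ⊕Σ (λ i → A (suc i) zero xor ⊕Σ (λ k → A (suc i) (suc k)))
    ≡⟨ cong₂ _xor_ (cong (_xor r) (irrefl zero)) (⊕Σ-xor (λ i → A (suc i) zero) (λ i → ⊕Σ (λ k → A (suc i) (suc k)))) ⟩
  r xor (⊕Σ (λ i → A (suc i) zero) xor ⊕Σ (λ i → ⊕Σ (λ k → A (suc i) (suc k))))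
    ≡⟨ cong (r xor_) (cong₂ _xor_ (⊕Σ-cong (λ i → symA (suc i) zero)) (handshake A' (λ i j → symA (suc i) (suc j)) (irrefl ∘ suc))) ⟩
  r xor (r xor false)
    ≡⟨ cong (r xor_) (xor-identityʳ r) ⟩
  r xor r
    ≡⟨ xor-same r ⟩
  false
    ∎
  where
  r = ⊕Σ (λ k → A zero (suc k))
  A' : Matrix n n
  A' i k = A (suc i) (suc k)

module _ {n} (Γ : Graph n) (sd : SelfDual (codeOf Γ)) where

  degree-odd : ∀ a → ⊕Σ (adj Γ a) ≡ true
  degree-odd a = begin
    ⊕Σ (adj Γ a)              ≡⟨ ⊕Σ-cong (λ k → sym (∧-idem (adj Γ a k))) ⟩
    dot (adj Γ a) (adj Γ a)   ≡⟨ selfDual⇒orthogonal (adj Γ) sd a a ⟩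
    does (a ≟ a)              ≡⟨ dec-true (a ≟ a) refl ⟩
    true                      ∎

  order-even : ⊕Σ {n} (λ _ → true) ≡ false
  order-even = trans (⊕Σ-cong (λ a → sym (degree-odd a))) (handshake (adj Γ) (Graph.sym Γ) (irref Γ))

module _ {n₁ n₂ : ℕ} (Γ₁ : Graph n₁) (Γ₂ : Graph n₂) where

  private
    JA : Matrix (n₁ + n₂) (n₁ + n₂)
    JA = joinAdj Γ₁ Γ₂
    A₁ : Matrix n₁ n₁
    A₁ = adj Γ₁
    A₂ : Matrix n₂ n₂
    A₂ = adj Γ₂

  joinAdj-↑ˡ↑ˡ : ∀ a b → JA (a ↑ˡ n₂) (b ↑ˡ n₂) ≡ A₁ a b
  joinAdj-↑ˡ↑ˡ a b rewrite splitAt-↑ˡ n₁ a n₂ | splitAt-↑ˡ n₁ b n₂ = refl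

  joinAdj-↑ˡ↑ʳ : ∀ a b → JA (a ↑ˡ n₂) (n₁ ↑ʳ b) ≡ true
  joinAdj-↑ˡ↑ʳ a b rewrite splitAt-↑ˡ n₁ a n₂ | splitAt-↑ʳ n₁ n₂ b = refl

  joinAdj-↑ʳ↑ˡ : ∀ a b → JA (n₁ ↑ʳ a) (b ↑ˡ n₂) ≡ true
  joinAdj-↑ʳ↑ˡ a b rewrite splitAt-↑ʳ n₁ n₂ a | splitAt-↑ˡ n₁ b n₂ = refl

  joinAdj-↑ʳ↑ʳ : ∀ a b → JA (n₁ ↑ʳ a) (n₁ ↑ʳ b) ≡ A₂ a b
  joinAdj-↑ʳ↑ʳ a b rewrite splitAt-↑ʳ n₁ n₂ a | splitAt-↑ʳ n₁ n₂ b = refl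

  joinAdj-symmetric : Symmetric JA
  joinAdj-symmetric i j with ↑-view n₁ i | ↑-view n₁ j
  ... | inj₁ (a , refl) | inj₁ (b , refl) =
    trans (joinAdj-↑ˡ↑ˡ a b) (trans (Graph.sym Γ₁ a b) (sym (joinAdj-↑ˡ↑ˡ b a)))
  ... | inj₁ (a , refl) | inj₂ (b , refl) = trans (joinAdj-↑ˡ↑ʳ a b) (sym (joinAdj-↑ʳ↑ˡ b a))
  ... | inj₂ (a , refl) | inj₁ (b , refl) = trans (joinAdj-↑ʳ↑ˡ a b) (sym (joinAdj-↑ˡ↑ʳ b a))
  ... | inj₂ (a , refl) | inj₂ (b , refl) =
    trans (joinAdj-↑ʳ↑ʳ a b) (trans (Graph.sym Γ₂ a b) (sym (joinAdj-↑ʳ↑ʳ b a)))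

  wt-joinAdj-↑ˡ : ∀ a → wt (JA (a ↑ˡ n₂)) ≡ degree Γ₁ a + n₂
  wt-joinAdj-↑ˡ a = trans (ΣN-splitAt n₁ (bit ∘ JA (a ↑ˡ n₂)))
    (cong₂ _+_ (ΣN-cong (cong bit ∘ joinAdj-↑ˡ↑ˡ a)) (trans (ΣN-cong (cong bit ∘ joinAdj-↑ˡ↑ʳ a)) (ΣN-1 {n₂})))

  wt-joinAdj-↑ʳ : ∀ b → wt (JA (n₁ ↑ʳ b)) ≡ n₁ + degree Γ₂ b
  wt-joinAdj-↑ʳ b = trans (ΣN-splitAt n₁ (bit ∘ JA (n₁ ↑ʳ b)))
    (cong₂ _+_ (trans (ΣN-cong (cong bit ∘ joinAdj-↑ʳ↑ˡ b)) (ΣN-1 {n₁})) (ΣN-cong (cong bit ∘ joinAdj-↑ʳ↑ʳ b)))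

  module _ (sd₁ : SelfDual (codeOf Γ₁)) (sd₂ : SelfDual (codeOf Γ₂)) where

    dot-joinAdj-↑ˡ↑ˡ : ∀ a b → dot (JA (a ↑ˡ n₂)) (JA (b ↑ˡ n₂)) ≡ does (a ≟ b)
    dot-joinAdj-↑ˡ↑ˡ a b = begin
      dot (JA (a ↑ˡ n₂)) (JA (b ↑ˡ n₂))
        ≡⟨ dot-splitAt n₁ (JA (a ↑ˡ n₂)) (JA (b ↑ˡ n₂)) ⟩
      _ ≡⟨ cong₂ _xor_ (dot-cong (joinAdj-↑ˡ↑ˡ a) (joinAdj-↑ˡ↑ˡ b)) (dot-cong (joinAdj-↑ˡ↑ʳ a) (joinAdj-↑ˡ↑ʳ b)) ⟩
      dot (A₁ a) (A₁ b) xor ⊕Σ {n₂} (λ _ → true)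
        ≡⟨ cong₂ _xor_ (selfDual⇒orthogonal A₁ sd₁ a b) (order-even Γ₂ sd₂) ⟩
      does (a ≟ b) xor false
        ≡⟨ xor-identityʳ _ ⟩
      does (a ≟ b)
        ∎

    dot-joinAdj-↑ˡ↑ʳ : ∀ a b → dot (JA (a ↑ˡ n₂)) (JA (n₁ ↑ʳ b)) ≡ false
    dot-joinAdj-↑ˡ↑ʳ a b = begin
      dot (JA (a ↑ˡ n₂)) (JA (n₁ ↑ʳ b))
        ≡⟨ dot-splitAt n₁ (JA (a ↑ˡ n₂)) (JA (n₁ ↑ʳ b)) ⟩
      _ ≡⟨ cong₂ _xor_ (dot-cong (joinAdj-↑ˡ↑ˡ a) (joinAdj-↑ʳ↑ˡ b)) (dot-cong (joinAdj-↑ˡ↑ʳ a) (joinAdj-↑ʳ↑ʳ b)) ⟩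
      ⊕Σ (λ k → A₁ a k ∧ true) xor ⊕Σ (A₂ b)
        ≡⟨ cong₂ _xor_ (trans (⊕Σ-cong (λ k → ∧-identityʳ (A₁ a k))) (degree-odd Γ₁ sd₁ a)) (degree-odd Γ₂ sd₂ b) ⟩
      false
        ∎

    dot-joinAdj-↑ʳ↑ʳ : ∀ a b → dot (JA (n₁ ↑ʳ a)) (JA (n₁ ↑ʳ b)) ≡ does (a ≟ b)
    dot-joinAdj-↑ʳ↑ʳ a b = begin
      dot (JA (n₁ ↑ʳ a)) (JA (n₁ ↑ʳ b))
        ≡⟨ dot-splitAt n₁ (JA (n₁ ↑ʳ a)) (JA (n₁ ↑ʳ b)) ⟩
      _ ≡⟨ cong₂ _xor_ (dot-cong (joinAdj-↑ʳ↑ˡ a) (joinAdj-↑ʳ↑ˡ b)) (dot-cong (joinAdj-↑ʳ↑ʳ a) (joinAdj-↑ʳ↑ʳ b)) ⟩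
      ⊕Σ {n₁} (λ _ → true) xor dot (A₂ a) (A₂ b)
        ≡⟨ cong₂ _xor_ (order-even Γ₁ sd₁) (selfDual⇒orthogonal A₂ sd₂ a b) ⟩
      does (a ≟ b)
        ∎

    joinAdj-orthogonal : Orthogonal JA
    joinAdj-orthogonal i j with ↑-view n₁ i | ↑-view n₁ j
    ... | inj₁ (a , refl) | inj₁ (b , refl) =
      trans (dot-joinAdj-↑ˡ↑ˡ a b) (sym (does-≟-injective (_↑ˡ n₂) (↑ˡ-injective n₂ _ _) a b))
    ... | inj₁ (a , refl) | inj₂ (b , refl) =
      trans (dot-joinAdj-↑ˡ↑ʳ a b) (sym (dec-false ((a ↑ˡ n₂) ≟ (n₁ ↑ʳ b)) (↑ˡ≢↑ʳ a b)))
    ... | inj₂ (a , refl) | inj₁ (b , refl) =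
      trans (dot-comm (JA (n₁ ↑ʳ a)) (JA (b ↑ˡ n₂)))
        (trans (dot-joinAdj-↑ˡ↑ʳ b a) (sym (dec-false ((n₁ ↑ʳ a) ≟ (b ↑ˡ n₂)) (↑ˡ≢↑ʳ b a ∘ sym))))
    ... | inj₂ (a , refl) | inj₂ (b , refl) =
      trans (dot-joinAdj-↑ʳ↑ʳ a b) (sym (does-≟-injective (n₁ ↑ʳ_) (↑ʳ-injective n₁ _ _) a b))

    join-selfDual : SelfDual (joinCode Γ₁ Γ₂)
    join-selfDual = symmetric-orthogonal⇒selfDual JA joinAdj-symmetric joinAdj-orthogonal

    join-doublyEven⇒4∣ : DoublyEven (joinCode Γ₁ Γ₂) → 4 ∣ n₁ + n₂
    join-doublyEven⇒4∣ = doublyEven⇒4∣ JA joinAdj-symmetric joinAdj-orthogonal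

  join-doublyEven⇔ : SelfDual (joinCode Γ₁ Γ₂)
    → DoublyEven (joinCode Γ₁ Γ₂) ⇔ ((∀ a → 4 ∣ n₂ + suc (degree Γ₁ a)) × (∀ b → 4 ∣ n₁ + suc (degree Γ₂ b)))
  join-doublyEven⇔ sd = mk⇔ (λ de → rowsˡ (to de) , rowsʳ (to de)) (from ∘ rows)
    where
    open Equivalence (doublyEven⇔rows JA sd)
    rowWeightˡ : ∀ a → suc (wt (JA (a ↑ˡ n₂))) ≡ n₂ + suc (degree Γ₁ a)
    rowWeightˡ a = trans (cong suc (trans (wt-joinAdj-↑ˡ a) (+-comm (degree Γ₁ a) n₂))) (sym (+-suc n₂ (degree Γ₁ a)))
    rowWeightʳ : ∀ b → suc (wt (JA (n₁ ↑ʳ b))) ≡ n₁ + suc (degree Γ₂ b)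
    rowWeightʳ b = trans (cong suc (wt-joinAdj-↑ʳ b)) (sym (+-suc n₁ (degree Γ₂ b)))
    rowsˡ : (∀ i → 4 ∣ suc (wt (JA i))) → ∀ a → 4 ∣ n₂ + suc (degree Γ₁ a)
    rowsˡ rows a = subst (4 ∣_) (rowWeightˡ a) (rows (a ↑ˡ n₂))
    rowsʳ : (∀ i → 4 ∣ suc (wt (JA i))) → ∀ b → 4 ∣ n₁ + suc (degree Γ₂ b)
    rowsʳ rows b = subst (4 ∣_) (rowWeightʳ b) (rows (n₁ ↑ʳ b))
    rows : (∀ a → 4 ∣ n₂ + suc (degree Γ₁ a)) × (∀ b → 4 ∣ n₁ + suc (degree Γ₂ b)) → ∀ i → 4 ∣ suc (wt (JA i))
    rows (rowsˡ , rowsʳ) i with ↑-view n₁ i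
    ... | inj₁ (a , refl) = subst (4 ∣_) (sym (rowWeightˡ a)) (rowsˡ a)
    ... | inj₂ (b , refl) = subst (4 ∣_) (sym (rowWeightʳ b)) (rowsʳ b)

∣m+n∣n⇒∣m : ∀ {d m n} → d ∣ m + n → d ∣ n → d ∣ m
∣m+n∣n⇒∣m {d} {m} {n} d∣m+n d∣n = ∣m+n∣m⇒∣n (subst (d ∣_) (+-comm m n) d∣m+n) d∣n

%4≡2⇒4∤ : ∀ n → n % 4 ≡ 2 → ¬ 4 ∣ n
%4≡2⇒4∤ n n%4≡2 4∣n with trans (sym (n∣m⇒m%n≡0 n 4 4∣n)) n%4≡2
... | ()

%4≡2⇒Fin : ∀ n → n % 4 ≡ 2 → Fin n
%4≡2⇒Fin (suc n) _ = zero

4∣[m+suc[n]] : ∀ m n → m % 4 ≡ 2 → n % 4 ≡ 1 → 4 ∣ m + suc n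
4∣[m+suc[n]] m n m%4≡2 n%4≡1 = m%n≡0⇒n∣m _ 4 (begin
  (m + suc n) % 4             ≡⟨ %-distribˡ-+ m (suc n) 4 ⟩
  (m % 4 + (1 + n) % 4) % 4   ≡⟨ cong₂ (λ x y → (x + y) % 4) m%4≡2 (%-distribˡ-+ 1 n 4) ⟩
  (2 + (1 + n % 4) % 4) % 4   ≡⟨ cong (λ y → (2 + (1 + y) % 4) % 4) n%4≡1 ⟩
  0                           ∎)

module _ {n₁ n₂ : ℕ} {Γ₁ : Graph n₁} {Γ₂ : Graph n₂} (sd₁ : SelfDual (codeOf Γ₁)) (sd₂ : SelfDual (codeOf Γ₂)) where

  private
    sdJ : SelfDual (joinCode Γ₁ Γ₂)
    sdJ = join-selfDual Γ₁ Γ₂ sd₁ sd₂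
    module Rows₁ = Equivalence (doublyEven⇔rows (adj Γ₁) sd₁)
    module Rows₂ = Equivalence (doublyEven⇔rows (adj Γ₂) sd₂)
    module RowsJ = Equivalence (join-doublyEven⇔ Γ₁ Γ₂ sdJ)

  join-typeII⇔typeII : 4 ∣ n₁ → 4 ∣ n₂ → TypeII (joinCode Γ₁ Γ₂) ⇔ (TypeII (codeOf Γ₁) × TypeII (codeOf Γ₂))
  join-typeII⇔typeII 4∣n₁ 4∣n₂ = mk⇔
    (λ (_ , de) → (sd₁ , Rows₁.from (λ a → ∣m+n∣m⇒∣n (proj₁ (RowsJ.to de) a) 4∣n₂))
                , (sd₂ , Rows₂.from (λ b → ∣m+n∣m⇒∣n (proj₂ (RowsJ.to de) b) 4∣n₁)))
    (λ ((_ , de₁) , (_ , de₂)) → sdJ , RowsJ.from ((λ a → ∣m∣n⇒∣m+n 4∣n₂ (Rows₁.to de₁ a))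
                                                 , (λ b → ∣m∣n⇒∣m+n 4∣n₁ (Rows₂.to de₂ b))))

  join-typeII⇒typeIˡ : Fin n₁ → ¬ 4 ∣ n₂ → TypeII (joinCode Γ₁ Γ₂) → TypeI (codeOf Γ₁)
  join-typeII⇒typeIˡ a 4∤n₂ (_ , de) = sd₁ , λ de₁ → 4∤n₂ (∣m+n∣n⇒∣m (proj₁ (RowsJ.to de) a) (Rows₁.to de₁ a))

  join-typeII⇒typeIʳ : Fin n₂ → ¬ 4 ∣ n₁ → TypeII (joinCode Γ₁ Γ₂) → TypeI (codeOf Γ₂)
  join-typeII⇒typeIʳ b 4∤n₁ (_ , de) = sd₂ , λ de₂ → 4∤n₁ (∣m+n∣n⇒∣m (proj₂ (RowsJ.to de) b) (Rows₂.to de₂ b))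

  join-typeII-of-degrees : n₁ % 4 ≡ 2 → n₂ % 4 ≡ 2
    → (∀ a → degree Γ₁ a % 4 ≡ 1) → (∀ b → degree Γ₂ b % 4 ≡ 1) → TypeII (joinCode Γ₁ Γ₂)
  join-typeII-of-degrees n₁≡2 n₂≡2 deg₁≡1 deg₂≡1 =
    sdJ , RowsJ.from ((λ a → 4∣[m+suc[n]] n₂ _ n₂≡2 (deg₁≡1 a)) , (λ b → 4∣[m+suc[n]] n₁ _ n₁≡2 (deg₂≡1 b)))

  join-typeI : ¬ 4 ∣ n₁ + n₂ → TypeI (joinCode Γ₁ Γ₂)
  join-typeI 4∤n = sdJ , 4∤n ∘ join-doublyEven⇒4∣ Γ₁ Γ₂ sd₁ sd₂

mainTheorem16 : (n₁ n₂ : ℕ) (Γ₁ : Graph n₁) (Γ₂ : Graph n₂)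
    → SelfDual (codeOf Γ₁) → SelfDual (codeOf Γ₂)
    → ((n₁ % 4 ≡ 0 → n₂ % 4 ≡ 0
          → (TypeII (joinCode Γ₁ Γ₂) → TypeII (codeOf Γ₁) × TypeII (codeOf Γ₂))
          × (TypeII (codeOf Γ₁) × TypeII (codeOf Γ₂) → TypeII (joinCode Γ₁ Γ₂)))
      × (n₁ % 4 ≡ 2 → n₂ % 4 ≡ 2
          → (TypeII (joinCode Γ₁ Γ₂) → TypeI (codeOf Γ₁) × TypeI (codeOf Γ₂))
          × ((∀ (v : Fin n₁) → degree Γ₁ v % 4 ≡ 1)
             → (∀ (v : Fin n₂) → degree Γ₂ v % 4 ≡ 1)
             → TypeII (joinCode Γ₁ Γ₂)))
      × ((4 ∣ n₁ × ¬ (4 ∣ n₂)) ⊎ (¬ (4 ∣ n₁) × 4 ∣ n₂)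
          → TypeI (joinCode Γ₁ Γ₂)))
mainTheorem16 n₁ n₂ Γ₁ Γ₂ sd₁ sd₂ =
    (λ n₁≡0 n₂≡0 → let open Equivalence (typeII⇔ n₁≡0 n₂≡0) in to , from)
  , (λ n₁≡2 n₂≡2 →
        (λ typeII → join-typeII⇒typeIˡ sd₁ sd₂ (%4≡2⇒Fin n₁ n₁≡2) (%4≡2⇒4∤ n₂ n₂≡2) typeII
                  , join-typeII⇒typeIʳ sd₁ sd₂ (%4≡2⇒Fin n₂ n₂≡2) (%4≡2⇒4∤ n₁ n₁≡2) typeII)
      , join-typeII-of-degrees sd₁ sd₂ n₁≡2 n₂≡2)
  , typeI
  where
  typeII⇔ : n₁ % 4 ≡ 0 → n₂ % 4 ≡ 0 → TypeII (joinCode Γ₁ Γ₂) ⇔ (TypeII (codeOf Γ₁) × TypeII (codeOf Γ₂))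
  typeII⇔ n₁≡0 n₂≡0 = join-typeII⇔typeII sd₁ sd₂ (m%n≡0⇒n∣m n₁ 4 n₁≡0) (m%n≡0⇒n∣m n₂ 4 n₂≡0)
  typeI : (4 ∣ n₁ × ¬ (4 ∣ n₂)) ⊎ (¬ (4 ∣ n₁) × 4 ∣ n₂) → TypeI (joinCode Γ₁ Γ₂)
  typeI (inj₁ (4∣n₁ , 4∤n₂)) = join-typeI sd₁ sd₂ (λ 4∣n → 4∤n₂ (∣m+n∣m⇒∣n 4∣n 4∣n₁))
  typeI (inj₂ (4∤n₁ , 4∣n₂)) = join-typeI sd₁ sd₂ (λ 4∣n → 4∤n₁ (∣m+n∣n⇒∣m 4∣n 4∣n₂))
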